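{- A connected finite simple graph $G$ satisfies that both $G$ and $\overline{G}$ are distance-hereditary if and only if $G$ admits a sequence of twin eliminations resulting in a graph isomorphic to an induced subgraph of the Bull.
   Context: A graph is distance-hereditary if it contains no induced hole (cycle of length at least $5$), house ($4$-cycle plus a vertex adjacent to exactly two adjacent vertices of the cycle), domino (two $4$-cycles sharing an edge), or gem ($P_4$ plus a vertex adjacent to all its vertices). Two vertices $u,v$ are twins if $N(u)\setminus\{u,v\}=N(v)\setminus\{u,v\}$; a twin elimination deletes one vertex of a pair of twins. The Bull is the $5$-vertex graph formed by a triangle $abc$ and two vertices $d,e$ with $d$ adjacent only to $a$ and $e$ adjacent only to $b$. -}

module Defs where

open import Data.Nat using (ℕ; zero; suc; _+_; _≡ᵇ_)
open import Data.Fin using (Fin; toℕ; punchIn; _≟_)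
open import Data.Fin.Properties using (punchIn-injective)
open import Data.Bool using (Bool; true; false; not; _∧_; _∨_; if_then_else_)
open import Data.Bool.Properties using (∨-comm)
open import Data.List using (List; []; _∷_)
open import Data.Bool.ListAction using (any)
open import Data.Product using (Σ; _×_; _,_; ∃; ∃-syntax)
open import Function using (Injective)
open import Function.Bundles using (_⇔_)
open import Relation.Nullary using (¬_; yes; no; Dec)
open import Relation.Nullary.Decidable using (⌊_⌋)
open import Relation.Binary.PropositionalEquality using (_≡_; _≢_; refl; sym)

record Graph (n : ℕ) : Set where
  field
    adj    : Fin n → Fin n → Bool
    symm   : ∀ i j → adj i j ≡ adj j i
    irrefl : ∀ i → adj i i ≡ false
open Graph public

private
  ≟-sym : ∀ {n} (i j : Fin n) → ⌊ i ≟ j ⌋ ≡ ⌊ j ≟ i ⌋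
  ≟-sym i j with i ≟ j | j ≟ i
  ... | yes _ | yes _ = refl
  ... | no _  | no _  = refl
  ... | yes p | no q  with q (sym p)
  ... | ()
  ≟-sym i j | no p | yes q with p (sym q)
  ... | ()

  ≟-refl : ∀ {n} (i : Fin n) → ⌊ i ≟ i ⌋ ≡ true
  ≟-refl i with i ≟ i
  ... | yes _ = refl
  ... | no q with q refl
  ... | ()

complement : ∀ {n} → Graph n → Graph n
complement {n} G = record { adj = a ; symm = s ; irrefl = r }
  where
  a : Fin n → Fin n → Bool
  a i j = if ⌊ i ≟ j ⌋ then false else not (adj G i j)
  s : ∀ i j → a i j ≡ a j i
  s i j rewrite ≟-sym i j | symm G i j = refl
  r : ∀ i → a i i ≡ false
  r i rewrite ≟-refl i = refl

fromEdges : ∀ {n} → (Fin n → Fin n → Bool) → Graph n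
fromEdges {n} e = record { adj = a ; symm = s ; irrefl = r }
  where
  a : Fin n → Fin n → Bool
  a i j = if ⌊ i ≟ j ⌋ then false else (e i j ∨ e j i)
  s : ∀ i j → a i j ≡ a j i
  s i j rewrite ≟-sym i j | ∨-comm (e i j) (e j i) = refl
  r : ∀ i → a i i ≡ false
  r i rewrite ≟-refl i = refl

edgeList : ∀ {n} → List (ℕ × ℕ) → Fin n → Fin n → Bool
edgeList es i j = any (λ { (a , b) → (a ≡ᵇ toℕ i) ∧ (b ≡ᵇ toℕ j) }) es

fromList : ∀ n → List (ℕ × ℕ) → Graph n
fromList n es = fromEdges (edgeList es)

cycleG : ∀ k → Graph k
cycleG k = fromEdges λ i j →
  (suc (toℕ i) ≡ᵇ toℕ j) ∨ ((toℕ j ≡ᵇ 0) ∧ (suc (toℕ i) ≡ᵇ k))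

house : Graph 5
house = fromList 5 ((0 , 1) ∷ (1 , 2) ∷ (2 , 3) ∷ (3 , 0) ∷ (4 , 0) ∷ (4 , 1) ∷ [])

-- Domino: 6-cycle 0-1-2-3-4-5-0 with chord 1-4 (4-cycles 0145 and 1234 share edge 14).
domino : Graph 6
domino = fromList 6 ((0 , 1) ∷ (1 , 2) ∷ (2 , 3) ∷ (3 , 4) ∷ (4 , 5) ∷ (5 , 0) ∷ (1 , 4) ∷ [])

gem : Graph 5
gem = fromList 5 ((0 , 1) ∷ (1 , 2) ∷ (2 , 3) ∷ (4 , 0) ∷ (4 , 1) ∷ (4 , 2) ∷ (4 , 3) ∷ [])

-- Bull: triangle 0 1 2 (a b c), vertex 3 (d) adjacent only to 0, vertex 4 (e) only to 1.
bull : Graph 5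
bull = fromList 5 ((0 , 1) ∷ (1 , 2) ∷ (2 , 0) ∷ (3 , 0) ∷ (4 , 1) ∷ [])

InducedSub : ∀ {m n} → Graph m → Graph n → Set
InducedSub {m} {n} H G =
  Σ (Fin m → Fin n) λ f → Injective _≡_ _≡_ f × (∀ i j → adj G (f i) (f j) ≡ adj H i j)

DistanceHereditary : ∀ {n} → Graph n → Set
DistanceHereditary G =
  (∀ k → ¬ InducedSub (cycleG (5 + k)) G) ×
  ¬ InducedSub house G × ¬ InducedSub domino G × ¬ InducedSub gem G

data Walk {n} (G : Graph n) : Fin n → Fin n → Set where
  here : ∀ {u} → Walk G u u
  step : ∀ {u v w} → adj G u v ≡ true → Walk G v w → Walk G u w

Connected : ∀ {n} → Graph n → Set
Connected G = ∀ u v → Walk G u v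

Twins : ∀ {n} → Graph n → Fin n → Fin n → Set
Twins G u v = ∀ w → w ≢ u → w ≢ v → adj G u w ≡ adj G v w

deleteV : ∀ {m} → Graph (suc m) → Fin (suc m) → Graph m
deleteV G v = record
  { adj = λ i j → adj G (punchIn v i) (punchIn v j)
  ; symm = λ i j → symm G (punchIn v i) (punchIn v j)
  ; irrefl = λ i → irrefl G (punchIn v i) }

data _⇝_ : ∀ {n m} → Graph n → Graph m → Set where
  done : ∀ {n} {G : Graph n} → G ⇝ G
  elim : ∀ {n m} {G : Graph (suc n)} {H : Graph m} (u v : Fin (suc n)) →
         u ≢ v → Twins G u v → deleteV G v ⇝ H → G ⇝ H

-- Both sides of the equivalence are governed by a finite family of obstructions: G and its
-- complement are distance-hereditary exactly when neither contains C₅, the house, the gem or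
-- the domino, since a longer hole contains P₅, the complement of the house.  These obstructions
-- have no twins, so an induced copy never needs both vertices of a twin pair; hence deleting a
-- twin does not change obstruction-freeness, and the bull is obstruction-free.
--
-- Conversely, delete twins until none are left.  A graph without an induced P₄ splits into two
-- nonempty parts joined uniformly (Seinsche), and recursing into a part produces twins; so a
-- twin-free graph on two or more vertices contains an induced P₄.  Take as core an induced bull
-- if there is one, and an induced P₄ otherwise.  A finite check shows that every vertex copies
-- the adjacencies of some core vertex, and that copies of distinct core vertices are joined
-- exactly as these are.  The copies of one core vertex thus form a module; a module with two
-- vertices contains twins or an induced P₄, and that P₄ with a vertex outside the module is a
-- gem or the complement of one.  So the twin-free graph is its core, an induced subgraph of the
-- bull.
module Submission where

open import Defs
open import Data.Nat using (ℕ; zero; suc; _+_; s≤s; z≤n)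
open import Data.Fin using (Fin; zero; suc; _≟_; punchIn; punchOut; _↑ˡ_)
open import Data.Fin.Properties
  using (all?; any?; punchIn-injective; punchIn-punchOut; punchInᵢ≢i; <⇒notInjective)
open import Data.Fin.Subset using (Subset; _⊂_) renaming (_∈_ to _∈ₛ_)
open import Data.Fin.Subset.Induction using (⊂-wellFounded)
open import Data.Bool using (Bool; true; false; not; _∧_; if_then_else_)
open import Data.Bool.ListAction using (all)
import Data.Bool.Properties as Bool
open import Data.Vec using (Vec; []; _∷_; lookup; tabulate)
open import Data.Vec.Properties using (lookup∘tabulate; lookup⇒[]=; []=⇒lookup)
open import Data.Vec.Functional using () renaming (_∷_ to _◂_)
import Data.List as List
open import Data.List using (List) renaming ([] to [ₗ]; _∷_ to _∷ₗ_)
open import Data.List.Relation.Unary.All as All using (All) renaming ([] to []ᵃ; _∷_ to _∷ᵃ_)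
open import Data.List.Relation.Unary.Any as Any using (Any; here; there)
import Data.Maybe as Maybe
open import Data.Maybe using (Maybe; just; nothing; _<∣>_; _>>=_; from-just) renaming (map to mapᴹ)
open import Data.Product using (Σ; ∃; ∃₂; _×_; _,_; proj₁; proj₂)
open import Data.Sum using (_⊎_; inj₁; inj₂; [_,_]′)
open import Data.Unit using (⊤; tt)
open import Data.Empty using (⊥; ⊥-elim)
open import Function using (_∘_; const; Injective)
open import Function.Bundles using (_⇔_; mk⇔)
open import Induction.WellFounded using (Acc; acc)
open import Level using (0ℓ)
open import Relation.Nullary using (¬_; Dec; yes; no; contradiction; does)
open import Relation.Nullary.Decidable
  using (map′; ¬?; _×-dec_; _⊎-dec_; _→-dec_; from-yes; from-no; dec-true; dec⇒maybe; True; toWitness;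
         decidable-stable)
open import Relation.Unary using (Pred; Decidable)
open import Relation.Binary.PropositionalEquality
open ≡-Reasoning

private
  variable
    k m n : ℕ

-- Induced subgraphs

Adj : ℕ → Set
Adj n = Fin n → Fin n → Bool

Preserves : Adj m → Adj n → (Fin m → Fin n) → Set
Preserves A L f = ∀ i j → L (f i) (f j) ≡ A i j

Preserves-∘ : {A : Adj k} {B : Adj m} {C : Adj n} {f : Fin k → Fin m} {g : Fin m → Fin n} →
              Preserves A B f → Preserves B C g → Preserves A C (g ∘ f)
Preserves-∘ {f = f} f-pres g-pres i j = trans (g-pres (f i) (f j)) (f-pres i j)

adj-sym : (G : Graph n) {u v : Fin n} {b : Bool} → adj G u v ≡ b → adj G v u ≡ b
adj-sym G {u} {v} uv≡b = trans (symm G v u) uv≡b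

-- Twin-freeness in the constructive form used for the fixed small graphs.
Separated : Graph m → Set
Separated X = ∀ i j → i ≢ j → ∃ λ r → r ≢ i × r ≢ j × adj X i r ≢ adj X j r

preserves⇒injective : (X : Graph m) (L : Adj n) {f : Fin m → Fin n} →
                      Separated X → Preserves (adj X) L f → Injective _≡_ _≡_ f
preserves⇒injective X L {f} sep pres {i} {j} fi≡fj with i ≟ j
... | yes i≡j = i≡j
... | no i≢j with sep i j i≢j
...   | r , _ , _ , differ = contradiction
  (begin
    adj X i r     ≡⟨ pres i r ⟨
    L (f i) (f r) ≡⟨ cong (λ x → L x (f r)) fi≡fj ⟩
    L (f j) (f r) ≡⟨ pres j r ⟩
    adj X j r     ∎)
  differ

preserves⇒InducedSub : (X : Graph m) (G : Graph n) → Separated X → ∃ (Preserves (adj X) (adj G)) →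
                       InducedSub X G
preserves⇒InducedSub X G sep (f , pres) = f , preserves⇒injective X (adj G) sep pres , pres

_≐_ : Graph n → Graph n → Set
G ≐ H = ∀ i j → adj G i j ≡ adj H i j

InducedSub-trans : {X : Graph k} {Y : Graph m} {Z : Graph n} →
                   InducedSub X Y → InducedSub Y Z → InducedSub X Z
InducedSub-trans (f , f-inj , f-pres) (g , g-inj , g-pres) =
  g ∘ f , f-inj ∘ g-inj , λ i j → trans (g-pres (f i) (f j)) (f-pres i j)

InducedSub-respʳ : {X : Graph m} {G H : Graph n} → G ≐ H → InducedSub X G → InducedSub X H
InducedSub-respʳ G≐H (f , f-inj , f-pres) = f , f-inj , λ i j → trans (sym (G≐H (f i) (f j))) (f-pres i j)

InducedSub-respˡ : {X Y : Graph m} {G : Graph n} → X ≐ Y → InducedSub X G → InducedSub Y G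
InducedSub-respˡ X≐Y (f , f-inj , f-pres) = f , f-inj , λ i j → trans (f-pres i j) (X≐Y i j)

complement-adj : (G : Graph n) {i j : Fin n} → i ≢ j → adj (complement G) i j ≡ not (adj G i j)
complement-adj G {i} {j} i≢j with i ≟ j
... | yes i≡j = contradiction i≡j i≢j
... | no _    = refl

complement-involutive : (G : Graph n) → complement (complement G) ≐ G
complement-involutive G i j with i ≟ j
... | yes refl = sym (irrefl G i)
... | no _     = Bool.not-involutive (adj G i j)

complement-mono : {X : Graph m} {G : Graph n} → InducedSub X G → InducedSub (complement X) (complement G)
complement-mono {X = X} {G} (f , f-inj , f-pres) = f , f-inj , pres
  where
  pres : Preserves (adj (complement X)) (adj (complement G)) f
  pres i j with i ≟ j
  ... | yes refl = irrefl (complement G) (f i)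
  ... | no i≢j   = trans (complement-adj G (i≢j ∘ f-inj)) (cong not (f-pres i j))

InducedSub-complement : {X : Graph m} {G : Graph n} → InducedSub (complement X) G → InducedSub X (complement G)
InducedSub-complement {X = X} {G} Xᶜ⊆G =
  InducedSub-respˡ {X = complement (complement X)} {Y = X} {G = complement G} (complement-involutive X)
    (complement-mono {X = complement X} {G = G} Xᶜ⊆G)

deleteV-sub : (G : Graph (suc n)) (v : Fin (suc n)) → InducedSub (deleteV G v) G
deleteV-sub G v = punchIn v , punchIn-injective v _ _ , λ i j → refl

deleteV-complement : (G : Graph (suc n)) (v : Fin (suc n)) →
                     deleteV (complement G) v ≐ complement (deleteV G v)
deleteV-complement G v i j with i ≟ j
... | yes refl = irrefl (deleteV (complement G) v) i
... | no i≢j   = complement-adj G (i≢j ∘ punchIn-injective v i j)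

extend : (Fin k → Bool) → Adj k → Adj (suc k)
extend r L zero    zero    = false
extend r L zero    (suc j) = r j
extend r L (suc i) zero    = r i
extend r L (suc i) (suc j) = L i j

extend-preserves : (G : Graph n) {L : Adj k} {w : Fin k → Fin n} {r : Fin k → Bool} (x : Fin n) →
                   Preserves L (adj G) w → (∀ j → adj G x (w j) ≡ r j) →
                   Preserves (extend r L) (adj G) (x ◂ w)
extend-preserves G x w-pres x-row zero    zero    = irrefl G x
extend-preserves G x w-pres x-row zero    (suc j) = x-row j
extend-preserves G x w-pres x-row (suc i) zero    = adj-sym G (x-row i)
extend-preserves G x w-pres x-row (suc i) (suc j) = w-pres i j

P₄ : Graph 4
P₄ = fromList 4 ((0 , 1) ∷ₗ (1 , 2) ∷ₗ (2 , 3) ∷ₗ [ₗ])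

P₅ : Graph 5
P₅ = fromList 5 ((0 , 1) ∷ₗ (1 , 2) ∷ₗ (2 , 3) ∷ₗ (3 , 4) ∷ₗ [ₗ])

preserves? : (A : Adj m) (L : Adj n) (f : Fin m → Fin n) → Dec (Preserves A L f)
preserves? A L f = all? λ i → all? λ j → L (f i) (f j) Bool.≟ A i j

separated? : (X : Graph m) → Dec (Separated X)
separated? X = all? λ i → all? λ j → ¬? (i ≟ j) →-dec
  any? λ r → ¬? (r ≟ i) ×-dec ¬? (r ≟ j) ×-dec ¬? (adj X i r Bool.≟ adj X j r)

-- Abstract, so that type checking never unfolds the large proofs computed by separated?.
abstract
  separated-by-decision : (X : Graph m) → True (separated? X) → Separated X
  separated-by-decision X = toWitness

∃-Vec? : ∀ m {P : Pred (Vec (Fin n) m) 0ℓ} → Decidable P → Dec (∃ P)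
∃-Vec? zero    P? = map′ ([] ,_) (λ { ([] , p) → p }) (P? [])
∃-Vec? (suc m) P? = map′ (λ (x , v , p) → x ∷ v , p) (λ { (x ∷ v , p) → x , v , p })
  (any? λ x → ∃-Vec? m (λ v → P? (x ∷ v)))

InducedSub? : (X : Graph m) → Separated X → (G : Graph n) → Dec (InducedSub X G)
InducedSub? {m} X sep G =
  map′ (λ (v , pres) → preserves⇒InducedSub X G sep (lookup v , pres)) from
       (∃-Vec? m (λ v → preserves? (adj X) (adj G) (lookup v)))
  where
  from : InducedSub X G → ∃ λ v → Preserves (adj X) (adj G) (lookup v)
  from (f , _ , pres) = tabulate f , λ i j →
    subst₂ (λ x y → adj G x y ≡ adj X i j) (sym (lookup∘tabulate f i)) (sym (lookup∘tabulate f j))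
      (pres i j)

first : {B : Set} → (Fin n → Maybe B) → Maybe B
first {zero}  f = nothing
first {suc n} f = f zero <∣> first (f ∘ suc)

-- Backtracking search, only used to propose candidates that occurrence? checks.  A constraint
-- (y , r) records an already placed vertex y: each remaining vertex i of A must be sent to some
-- x with L y x ≡ r i.
findMap : Adj m → Adj n → List (Fin n × (Fin m → Bool)) → Maybe (Vec (Fin n) m)
findMap {zero}  A L cs = just []
findMap {suc m} A L cs = first λ x →
  if all (λ (y , r) → not (does (y ≟ x)) ∧ does (L y x Bool.≟ r zero)) cs
  then mapᴹ (x ∷_) (findMap (λ i j → A (suc i) (suc j)) L
                      ((x , A zero ∘ suc) ∷ₗ List.map (λ (y , r) → y , r ∘ suc) cs))
  else nothing

occurrence? : (A : Adj m) (L : Adj n) → Maybe (∃ (Preserves A L))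
occurrence? A L = findMap A L [ₗ] >>= λ v → mapᴹ (lookup v ,_) (dec⇒maybe (preserves? A L (lookup v)))

all-Bool? : {P : Bool → Set} → (∀ b → Maybe (P b)) → Maybe (∀ b → P b)
all-Bool? f = Maybe.zipWith (λ p q → λ { true → p ; false → q }) (f true) (f false)

all-Fin? : {P : Fin n → Set} → (∀ i → Maybe (P i)) → Maybe (∀ i → P i)
all-Fin? {zero}  f = just λ ()
all-Fin? {suc n} f = Maybe.zipWith (λ p q → λ { zero → p ; (suc i) → q i }) (f zero) (all-Fin? (f ∘ suc))

all-Vec? : {P : Vec Bool n → Set} → (∀ v → Maybe (P v)) → Maybe (∀ v → P v)
all-Vec? {zero}      f = mapᴹ (λ p → λ { [] → p }) (f [])
all-Vec? {suc n} {P} f = mapᴹ (λ g → λ { (b ∷ v) → g b v })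
  (all-Bool? λ b → all-Vec? {P = λ v → P (b ∷ v)} λ v → f (b ∷ v))

-- Removing a twin

TwinFree : Graph n → Set
TwinFree G = ∀ {u v} → u ≢ v → ¬ Twins G u v

twins? : (G : Graph n) (u v : Fin n) → Dec (Twins G u v)
twins? G u v = all? λ w → ¬? (w ≟ u) →-dec (¬? (w ≟ v) →-dec (adj G u w Bool.≟ adj G v w))

Twins-complement : (G : Graph n) {u v : Fin n} → Twins G u v → Twins (complement G) u v
Twins-complement G tw w w≢u w≢v =
  trans (complement-adj G (w≢u ∘ sym))
    (trans (cong not (tw w w≢u w≢v)) (sym (complement-adj G (w≢v ∘ sym))))

avoiding⇒InducedSub-deleteV : {X : Graph m} {G : Graph (suc n)} {v : Fin (suc n)} →
                              ((f , _) : InducedSub X G) → (∀ i → f i ≢ v) → InducedSub X (deleteV G v)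
avoiding⇒InducedSub-deleteV {X = X} {G} {v} (f , f-inj , f-pres) f≢v = g , g-inj , g-pres
  where
  g : _ → _
  g i = punchOut (f≢v i ∘ sym)
  punchIn-g : ∀ i → punchIn v (g i) ≡ f i
  punchIn-g i = punchIn-punchOut (f≢v i ∘ sym)
  g-inj : Injective _≡_ _≡_ g
  g-inj {i} {j} gi≡gj = f-inj (trans (sym (punchIn-g i)) (trans (cong (punchIn v) gi≡gj) (punchIn-g j)))
  g-pres : Preserves (adj X) (adj (deleteV G v)) g
  g-pres i j rewrite punchIn-g i | punchIn-g j = f-pres i j

twins-not-both : (X : Graph m) (G : Graph n) {u v : Fin n} → Separated X → u ≢ v → Twins G u v →
                 ((f , _) : InducedSub X G) → ∀ {i j} → f i ≡ u → f j ≡ v → ⊥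
twins-not-both X G {u} {v} sep u≢v tw (f , f-inj , f-pres) {i} {j} fi≡u fj≡v
  with sep i j (λ i≡j → u≢v (trans (sym fi≡u) (trans (cong f i≡j) fj≡v)))
... | r , r≢i , r≢j , differ = differ
  (begin
    adj X i r         ≡⟨ f-pres i r ⟨
    adj G (f i) (f r) ≡⟨ cong (λ x → adj G x (f r)) fi≡u ⟩
    adj G u (f r)     ≡⟨ tw (f r) (λ fr≡u → r≢i (f-inj (trans fr≡u (sym fi≡u))))
                              (λ fr≡v → r≢j (f-inj (trans fr≡v (sym fj≡v)))) ⟩
    adj G v (f r)     ≡⟨ cong (λ x → adj G x (f r)) fj≡v ⟨
    adj G (f j) (f r) ≡⟨ f-pres j r ⟩
    adj X j r         ∎)

twin-exchange : (X : Graph m) (G : Graph n) {u v : Fin n} → Separated X → Twins G u v →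
                ((f , _) : InducedSub X G) → ∀ {i₀} → f i₀ ≡ v → (∀ i → f i ≢ u) →
                Σ (InducedSub X G) λ (g , _) → ∀ i → g i ≢ v
twin-exchange X G {u} {v} sep tw (f , f-inj , f-pres) {i₀} fi₀≡v u∉f =
  preserves⇒InducedSub X G sep (g , g-pres) , g≢v
  where
  g : Fin _ → Fin _
  g i with i ≟ i₀
  ... | yes _ = u
  ... | no _  = f i
  g≢v : ∀ i → g i ≢ v
  g≢v i with i ≟ i₀
  ... | yes _   = λ u≡v → u∉f i₀ (trans fi₀≡v (sym u≡v))
  ... | no i≢i₀ = λ fi≡v → i≢i₀ (f-inj (trans fi≡v (sym fi₀≡v)))
  u-row : ∀ j → j ≢ i₀ → adj G u (f j) ≡ adj X i₀ j
  u-row j j≢i₀ = begin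
    adj G u (f j)      ≡⟨ tw (f j) (u∉f j) (λ fj≡v → j≢i₀ (f-inj (trans fj≡v (sym fi₀≡v)))) ⟩
    adj G v (f j)      ≡⟨ cong (λ x → adj G x (f j)) fi₀≡v ⟨
    adj G (f i₀) (f j) ≡⟨ f-pres i₀ j ⟩
    adj X i₀ j         ∎
  g-pres : Preserves (adj X) (adj G) g
  g-pres i j with i ≟ i₀ | j ≟ i₀
  ... | yes refl | yes refl = trans (irrefl G u) (sym (irrefl X i))
  ... | yes refl | no j≢i₀  = u-row j j≢i₀
  ... | no i≢i₀  | yes refl = trans (adj-sym G (u-row i i≢i₀)) (symm X j i)
  ... | no _     | no _     = f-pres i j

twin-removable : (X : Graph m) (G : Graph (suc n)) {u v : Fin (suc n)} →
                 Separated X → u ≢ v → Twins G u v →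
                 InducedSub X G → InducedSub X (deleteV G v)
twin-removable X G {u} {v} sep u≢v tw X⊆G@(f , _) with any? (λ i → f i ≟ v)
... | no v∉f = avoiding⇒InducedSub-deleteV {X = X} {G} X⊆G (λ i fi≡v → v∉f (i , fi≡v))
... | yes (i₀ , fi₀≡v) with any? (λ i → f i ≟ u)
...   | yes (i₁ , fi₁≡u) = ⊥-elim (twins-not-both X G sep u≢v tw X⊆G fi₁≡u fi₀≡v)
...   | no u∉f with twin-exchange X G sep tw X⊆G fi₀≡v (λ i fi≡u → u∉f (i , fi≡u))
...     | X⊆G′ , avoids-v = avoiding⇒InducedSub-deleteV {X = X} {G} X⊆G′ avoids-v

-- Obstructions

data Obstruction : Graph m → Set where
  C₅     : Obstruction (cycleG 5)
  House  : Obstruction house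
  Gem    : Obstruction gem
  Domino : Obstruction domino

ObstructionFree : Graph n → Set
ObstructionFree G = ∀ {m} {X : Graph m} → Obstruction X → ¬ InducedSub X G × ¬ InducedSub X (complement G)

obstruction-separated : {X : Graph m} → Obstruction X → Separated X
obstruction-separated C₅     = separated-by-decision (cycleG 5) _
obstruction-separated House  = separated-by-decision house _
obstruction-separated Gem    = separated-by-decision gem _
obstruction-separated Domino = separated-by-decision domino _

ObstructionFree-mono : {H : Graph m} {G : Graph n} → InducedSub H G → ObstructionFree G → ObstructionFree H
ObstructionFree-mono {H = H} {G} H⊆G free {X = X} o =
  (λ X⊆H → proj₁ (free o) (InducedSub-trans {X = X} {H} {G} X⊆H H⊆G)) ,
  (λ X⊆Hᶜ → proj₂ (free o) (InducedSub-trans {X = X} {complement H} {complement G} X⊆Hᶜ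
    (complement-mono {X = H} {G} H⊆G)))

ObstructionFree-complement : (G : Graph n) → ObstructionFree G → ObstructionFree (complement G)
ObstructionFree-complement G free {X = X} o =
  proj₂ (free o) ,
  λ X⊆Gᶜᶜ → proj₁ (free o) (InducedSub-respʳ {X = X} {complement (complement G)} {G}
    (complement-involutive G) X⊆Gᶜᶜ)

ObstructionFree-twin : (G : Graph (suc n)) {u v : Fin (suc n)} → u ≢ v → Twins G u v →
                       ObstructionFree (deleteV G v) → ObstructionFree G
ObstructionFree-twin G {u} {v} u≢v tw free {X = X} o =
  (λ X⊆G → proj₁ (free o) (twin-removable X G sep u≢v tw X⊆G)) ,
  (λ X⊆Gᶜ → proj₂ (free o) (InducedSub-respʳ {X = X} {deleteV (complement G) v} {complement (deleteV G v)}
    (deleteV-complement G v)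
    (twin-removable X (complement G) sep u≢v (Twins-complement G tw) X⊆Gᶜ)))
  where
  sep = obstruction-separated o

ObstructionFree-bull : ObstructionFree bull
ObstructionFree-bull C₅     = from-no (InducedSub? (cycleG 5) (obstruction-separated C₅) bull) ,
                              from-no (InducedSub? (cycleG 5) (obstruction-separated C₅) (complement bull))
ObstructionFree-bull House  = from-no (InducedSub? house (obstruction-separated House) bull) ,
                              from-no (InducedSub? house (obstruction-separated House) (complement bull))
ObstructionFree-bull Gem    = from-no (InducedSub? gem (obstruction-separated Gem) bull) ,
                              from-no (InducedSub? gem (obstruction-separated Gem) (complement bull))
ObstructionFree-bull Domino = too-large bull , too-large (complement bull)
  where
  too-large : (G : Graph 5) → ¬ InducedSub domino G
  too-large _ (_ , f-inj , _) = <⇒notInjective (s≤s (s≤s (s≤s (s≤s (s≤s (s≤s z≤n)))))) f-inj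

P₅⊆hole : ∀ k → InducedSub P₅ (cycleG (6 + k))
P₅⊆hole k = preserves⇒InducedSub P₅ (cycleG (6 + k)) (separated-by-decision P₅ _)
  (_↑ˡ suc k , from-yes (preserves? (adj P₅) (adj (cycleG (6 + k))) (_↑ˡ suc k)))

house⊆P₅ᶜ : InducedSub house (complement P₅)
house⊆P₅ᶜ = preserves⇒InducedSub house (complement P₅) (obstruction-separated House)
  (from-just (occurrence? (adj house) (adj (complement P₅))))

ObstructionFree⇒hole-free : (G : Graph n) → ObstructionFree G → ∀ k → ¬ InducedSub (cycleG (5 + k)) G
ObstructionFree⇒hole-free G free zero            = proj₁ (free C₅)
ObstructionFree⇒hole-free G free (suc k) hole⊆G = proj₂ (free House)
  (InducedSub-trans {X = house} {complement P₅} {complement G} house⊆P₅ᶜ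
    (complement-mono {X = P₅} {G} (InducedSub-trans {X = P₅} {cycleG (6 + k)} {G} (P₅⊆hole k) hole⊆G)))

ObstructionFree⇒DH : (G : Graph n) → ObstructionFree G → DistanceHereditary G
ObstructionFree⇒DH G free =
  ObstructionFree⇒hole-free G free , proj₁ (free House) , proj₁ (free Domino) , proj₁ (free Gem)

DH⇒ObstructionFree : (G : Graph n) → DistanceHereditary G → DistanceHereditary (complement G) →
                     ObstructionFree G
DH⇒ObstructionFree G (holes , no-house , no-domino , no-gem) (holesᶜ , no-houseᶜ , no-dominoᶜ , no-gemᶜ) =
  λ where
    C₅     → holes 0 , holesᶜ 0
    House  → no-house , no-houseᶜ
    Gem    → no-gem , no-gemᶜ
    Domino → no-domino , no-dominoᶜ

⇝-ObstructionFree : {G : Graph n} {H : Graph m} → G ⇝ H → InducedSub H bull → ObstructionFree G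
⇝-ObstructionFree {H = H} done H⊆bull = ObstructionFree-mono {H = H} {bull} H⊆bull ObstructionFree-bull
⇝-ObstructionFree {G = G} (elim u v u≢v tw G⇝H) H⊆bull =
  ObstructionFree-twin G u≢v tw (⇝-ObstructionFree G⇝H H⊆bull)

-- Twins or an induced P₄

≢not⇒≡ : ∀ {x y : Bool} → x ≢ not y → x ≡ y
≢not⇒≡ {y = y} x≢noty = trans (Bool.¬-not x≢noty) (Bool.not-involutive y)

≡not⇒≢ : ∀ {x y : Bool} → x ≡ not y → x ≢ y
≡not⇒≢ x≡noty x≡y = Bool.not-¬ refl (trans (sym x≡y) x≡noty)

-- Decidable vertex sets are measured by the corresponding Subset, whose strict inclusion is
-- well founded.
⟦_⟧ : {P : Pred (Fin n) 0ℓ} → Decidable P → Subset n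
⟦ P? ⟧ = tabulate (does ∘ P?)

∈⟦⟧⁺ : {P : Pred (Fin n) 0ℓ} (P? : Decidable P) {x : Fin n} → P x → x ∈ₛ ⟦ P? ⟧
∈⟦⟧⁺ P? {x} Px = lookup⇒[]= x _ (trans (lookup∘tabulate (does ∘ P?) x) (dec-true (P? x) Px))

∈⟦⟧⁻ : {P : Pred (Fin n) 0ℓ} (P? : Decidable P) {x : Fin n} → x ∈ₛ ⟦ P? ⟧ → P x
∈⟦⟧⁻ P? {x} x∈P with P? x | trans (sym (lookup∘tabulate (does ∘ P?) x)) ([]=⇒lookup x∈P)
... | yes Px | _ = Px
... | no _   | ()

⟦⟧-⊂ : {P Q : Pred (Fin n) 0ℓ} (Q? : Decidable Q) (P? : Decidable P) →
       (∀ {x} → Q x → P x) → ∀ {x} → P x → ¬ Q x → ⟦ Q? ⟧ ⊂ ⟦ P? ⟧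
⟦⟧-⊂ Q? P? Q⊆P {x} Px ¬Qx =
  (λ y∈Q → ∈⟦⟧⁺ P? (Q⊆P (∈⟦⟧⁻ Q? y∈Q))) , x , ∈⟦⟧⁺ P? Px , ¬Qx ∘ ∈⟦⟧⁻ Q?

_∖_ : Pred (Fin n) 0ℓ → Fin n → Pred (Fin n) 0ℓ
(P ∖ a) x = P x × x ≢ a

_∖?_ : {P : Pred (Fin n) 0ℓ} → Decidable P → (a : Fin n) → Decidable (P ∖ a)
(P? ∖? a) x = P? x ×-dec ¬? (x ≟ a)

module _ (G : Graph n) where

  InducedP₄ : Pred (Fin n) 0ℓ → Set
  InducedP₄ P = ∃ λ f → (∀ i → P (f i)) × Preserves (adj P₄) (adj G) f

  TwinsIn : Pred (Fin n) 0ℓ → Set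
  TwinsIn P = ∃₂ λ u v → u ≢ v × P u × P v ×
                         (∀ {w} → P w → w ≢ u → w ≢ v → adj G u w ≡ adj G v w)

  record Split (P : Pred (Fin n) 0ℓ) : Set₁ where
    field
      Side    : Pred (Fin n) 0ℓ
      side?   : Decidable Side
      bond    : Bool
      inner   : ∃ λ x → P x × Side x
      outer   : ∃ λ y → P y × ¬ Side y
      uniform : ∀ {x y} → P x → P y → Side x → ¬ Side y → adj G x y ≡ bond
  open Split

  swap : {P : Pred (Fin n) 0ℓ} → Split P → Split P
  swap s = record
    { Side    = ¬_ ∘ Side s
    ; side?   = ¬? ∘ side? s
    ; bond    = bond s
    ; inner   = outer s
    ; outer   = let (x , Px , Sx) = inner s in x , Px , λ ¬Sx → ¬Sx Sx
    ; uniform = λ {x} {y} Px Py ¬Sx ¬¬Sy →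
        trans (symm G x y) (uniform s Py Px (decidable-stable (side? s y) ¬¬Sy) ¬Sx)
    }

  attach-split : {P T : Pred (Fin n) 0ℓ} {a : Fin n} {c : Bool} → Decidable T → P a →
                 (∃ λ y → (P ∖ a) y × ¬ T y) →
                 (∀ {y} → (P ∖ a) y → ¬ T y → adj G a y ≡ c) →
                 (∀ {x y} → (P ∖ a) x → (P ∖ a) y → T x → ¬ T y → adj G x y ≡ c) → Split P
  attach-split {P} {T} {a} {c} T? Pa (y₀ , (Py₀ , y₀≢a) , ¬Ty₀) a-row T-uniform = record
    { Side    = λ x → x ≡ a ⊎ T x
    ; side?   = λ x → (x ≟ a) ⊎-dec T? x
    ; bond    = c
    ; inner   = a , Pa , inj₁ refl
    ; outer   = y₀ , Py₀ , λ { (inj₁ y₀≡a) → y₀≢a y₀≡a ; (inj₂ Ty₀) → ¬Ty₀ Ty₀ }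
    ; uniform = joined
    }
    where
    joined : ∀ {x y} → P x → P y → x ≡ a ⊎ T x → ¬ (y ≡ a ⊎ T y) → adj G x y ≡ c
    joined {x} Px Py Sx ¬Sy with x ≟ a | Sx
    ... | yes refl | _      = a-row (Py , ¬Sy ∘ inj₁) (¬Sy ∘ inj₂)
    ... | no x≢a   | inj₁ x≡a = contradiction x≡a x≢a
    ... | no x≢a   | inj₂ Tx  = T-uniform (Px , x≢a) (Py , ¬Sy ∘ inj₁) Tx (¬Sy ∘ inj₂)

  P₄-path : ∀ {w x y z} → adj G w x ≡ true → adj G x y ≡ true → adj G y z ≡ true →
            adj G w y ≡ false → adj G x z ≡ false → adj G w z ≡ false →
            Preserves (adj P₄) (adj G) (lookup (w ∷ x ∷ y ∷ z ∷ []))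
  P₄-path {w} {x} {y} {z} wx xy yz wy xz wz = λ where
    zero                   zero                   → irrefl G w
    zero                   (suc zero)             → wx
    zero                   (suc (suc zero))       → wy
    zero                   (suc (suc (suc zero))) → wz
    (suc zero)             zero                   → adj-sym G wx
    (suc zero)             (suc zero)             → irrefl G x
    (suc zero)             (suc (suc zero))       → xy
    (suc zero)             (suc (suc (suc zero))) → xz
    (suc (suc zero))       zero                   → adj-sym G wy
    (suc (suc zero))       (suc zero)             → adj-sym G xy
    (suc (suc zero))       (suc (suc zero))       → irrefl G y
    (suc (suc zero))       (suc (suc (suc zero))) → yz
    (suc (suc (suc zero))) zero                   → adj-sym G wz
    (suc (suc (suc zero))) (suc zero)             → adj-sym G xz
    (suc (suc (suc zero))) (suc (suc zero))       → adj-sym G yz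
    (suc (suc (suc zero))) (suc (suc (suc zero))) → irrefl G z

  P₄-from-bond : {P : Pred (Fin n) 0ℓ} {a m n′ w : Fin n} (c : Bool) → P a → P m → P n′ → P w →
                 adj G a m ≡ c → adj G a n′ ≡ not c → adj G m n′ ≡ not c →
                 adj G a w ≡ not c → adj G m w ≡ c → adj G n′ w ≡ c → InducedP₄ P
  P₄-from-bond {P} {a} {m} {n′} {w} false Pa Pm Pn Pw am an mn aw mw nw =
    _ , members , P₄-path mn (adj-sym G an) aw (adj-sym G am) nw mw
    where
    members : ∀ i → P (lookup (m ∷ n′ ∷ a ∷ w ∷ []) i)
    members = λ { zero → Pm ; (suc zero) → Pn ; (suc (suc zero)) → Pa ; (suc (suc (suc zero))) → Pw }
  P₄-from-bond {P} {a} {m} {n′} {w} true Pa Pm Pn Pw am an mn aw mw nw =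
    _ , members , P₄-path am mw (adj-sym G nw) aw mn an
    where
    members : ∀ i → P (lookup (a ∷ m ∷ w ∷ n′ ∷ []) i)
    members = λ { zero → Pa ; (suc zero) → Pm ; (suc (suc zero)) → Pw ; (suc (suc (suc zero))) → Pn }

  singleton-split : {P : Pred (Fin n) 0ℓ} {a : Fin n} {c : Bool} → P a → ∃ (P ∖ a) →
                    (∀ {y} → (P ∖ a) y → adj G a y ≡ c) → Split P
  singleton-split Pa (y , P′y) a-row =
    attach-split {T = λ _ → ⊥} (λ _ → no λ ()) Pa (y , P′y , λ ()) (λ P′y _ → a-row P′y) (λ _ _ ())

  same-side : {Q : Pred (Fin n) 0ℓ} (s : Split Q) {x y : Fin n} → Q x → Q y →
              adj G x y ≢ bond s → Side s x → Side s y
  same-side s {y = y} Qx Qy xy≢c Sx with side? s y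
  ... | yes Sy = Sy
  ... | no ¬Sy = contradiction (uniform s Qx Qy Sx ¬Sy) xy≢c

  attach-or-P₄ : {P : Pred (Fin n) 0ℓ} (P? : Decidable P) {a m n′ : Fin n} → P a → (s : Split (P ∖ a)) →
                 (P ∖ a) m → (P ∖ a) n′ → Side s m → Side s n′ →
                 adj G a m ≡ bond s → adj G a n′ ≡ not (bond s) → adj G m n′ ≡ not (bond s) →
                 InducedP₄ P ⊎ Split P
  attach-or-P₄ P? {a} Pa s P′m P′n Sm Sn am an mn
    with any? (λ w → (P? ∖? a) w ×-dec ¬? (side? s w) ×-dec (adj G a w Bool.≟ not (bond s)))
  ... | yes (w , P′w , ¬Sw , aw) =
    inj₁ (P₄-from-bond (bond s) Pa (proj₁ P′m) (proj₁ P′n) (proj₁ P′w) am an mn aw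
            (uniform s P′m P′w Sm ¬Sw) (uniform s P′n P′w Sn ¬Sw))
  ... | no ∄w = inj₂ (attach-split (side? s) Pa (outer s)
                        (λ P′y ¬Sy → ≢not⇒≡ λ ay≡¬c → ∄w (_ , P′y , ¬Sy , ay≡¬c)) (uniform s))

  -- Seinsche's step, with c the bond.  If a is c-adjacent to no vertex, it splits off alone.
  -- Otherwise look for m and n′ with a m c-adjacent but a n′ and m n′ not.  If there are none,
  -- a joins the vertices it is not c-adjacent to.  If there are, m and n′ lie on one side; a
  -- vertex on the other side not c-adjacent to a closes a P₄, and without one a joins that side.
  split-add-vertex : {P : Pred (Fin n) 0ℓ} (P? : Decidable P) {a : Fin n} → P a → Split (P ∖ a) →
                     InducedP₄ P ⊎ Split P
  split-add-vertex P? {a} Pa s with any? (λ y → (P? ∖? a) y ×-dec (adj G a y Bool.≟ bond s))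
  ... | no ∄y = inj₂ (singleton-split Pa (proj₁ (inner s) , proj₁ (proj₂ (inner s)))
                       (λ P′y → Bool.¬-not λ ay≡c → ∄y (_ , P′y , ay≡c)))
  ... | yes (m , P′m , am≡c)
    with any? (λ y → any? λ x → (P? ∖? a) y ×-dec (P? ∖? a) x ×-dec (adj G a y Bool.≟ bond s) ×-dec
                                (adj G a x Bool.≟ not (bond s)) ×-dec (adj G y x Bool.≟ not (bond s)))
  ...   | no ∄pair = inj₂ (attach-split (λ x → adj G a x Bool.≟ not (bond s)) Pa
                            (m , P′m , Bool.not-¬ am≡c)
                            (λ _ ay≢¬c → ≢not⇒≡ ay≢¬c)
                            (λ P′x P′y ax≡¬c ay≢¬c → adj-sym G (≢not⇒≡ λ yx≡¬c →
                               ∄pair (_ , _ , P′y , P′x , ≢not⇒≡ ay≢¬c , ax≡¬c , yx≡¬c))))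
  ...   | yes (m′ , n′ , P′m′ , P′n′ , am′ , an′ , m′n′) with side? s m′
  ...     | yes Sm′ = attach-or-P₄ P? Pa s P′m′ P′n′ Sm′
                        (same-side s P′m′ P′n′ (≡not⇒≢ m′n′) Sm′) am′ an′ m′n′
  ...     | no ¬Sm′ = attach-or-P₄ P? Pa (swap s) P′m′ P′n′ ¬Sm′
                        (same-side (swap s) P′m′ P′n′ (≡not⇒≢ m′n′) ¬Sm′) am′ an′ m′n′

  split-or-P₄ : {P : Pred (Fin n) 0ℓ} (P? : Decidable P) → Acc _⊂_ ⟦ P? ⟧ →
                ∀ {a b} → P a → P b → a ≢ b → InducedP₄ P ⊎ Split P
  split-or-P₄ {P} P? (acc rs) {a} {b} Pa Pb a≢b with any? ((P? ∖? a) ∖? b)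
  ... | no ∄z = inj₂ (singleton-split Pa (b , Pb , a≢b ∘ sym) (cong (adj G a) ∘ only-b))
    where
    only-b : ∀ {y} → (P ∖ a) y → y ≡ b
    only-b {y} P′y with y ≟ b
    ... | yes y≡b = y≡b
    ... | no y≢b  = ⊥-elim (∄z (y , P′y , y≢b))
  ... | yes (z , P′z , z≢b)
    with split-or-P₄ (P? ∖? a) (rs (⟦⟧-⊂ (P? ∖? a) P? proj₁ Pa λ (_ , a≢a) → a≢a refl))
                     (Pb , a≢b ∘ sym) P′z (z≢b ∘ sym)
  ...   | inj₁ (f , f∈P′ , f-pres) = inj₁ (f , proj₁ ∘ f∈P′ , f-pres)
  ...   | inj₂ s = split-add-vertex P? Pa s

  twins-lift : {P Q : Pred (Fin n) 0ℓ} → Decidable Q → (∀ {x} → Q x → P x) →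
               (∀ {u v w} → Q u → Q v → P w → ¬ Q w → adj G u w ≡ adj G v w) → TwinsIn Q → TwinsIn P
  twins-lift {P} Q? Q⊆P outside (u , v , u≢v , Qu , Qv , tw) = u , v , u≢v , Q⊆P Qu , Q⊆P Qv , tw′
    where
    tw′ : ∀ {w} → P w → w ≢ u → w ≢ v → adj G u w ≡ adj G v w
    tw′ {w} Pw w≢u w≢v with Q? w
    ... | yes Qw = tw Qw w≢u w≢v
    ... | no ¬Qw = outside Qu Qv Pw ¬Qw

  twins-or-P₄ : {P : Pred (Fin n) 0ℓ} (P? : Decidable P) → Acc _⊂_ ⟦ P? ⟧ →
                ∀ {a b} → P a → P b → a ≢ b → TwinsIn P ⊎ InducedP₄ P
  twins-or-P₄ {P} P? (acc rs) Pa Pb a≢b with split-or-P₄ P? (acc rs) Pa Pb a≢b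
  ... | inj₁ p₄ = inj₂ p₄
  ... | inj₂ s  = from-split s
    where
    Part : Split P → Pred (Fin n) 0ℓ
    Part t x = P x × Side t x

    part? : (t : Split P) → Decidable (Part t)
    part? t x = P? x ×-dec side? t x

    another? : (t : Split P) → Dec (∃ λ z → Part t z × z ≢ proj₁ (inner t))
    another? t = any? λ z → part? t z ×-dec ¬? (z ≟ proj₁ (inner t))

    from-part : (t : Split P) → ∃ (λ z → Part t z × z ≢ proj₁ (inner t)) → TwinsIn P ⊎ InducedP₄ P
    from-part t (z , Tz , z≢x) with inner t | outer t
    ... | x , Px , Sx | y , Py , ¬Sy
      with twins-or-P₄ (part? t) (rs (⟦⟧-⊂ (part? t) P? proj₁ Py (¬Sy ∘ proj₂)))
                       (Px , Sx) Tz (z≢x ∘ sym)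
    ...   | inj₁ tw = inj₁ (twins-lift (part? t) proj₁
                        (λ (Pu , Su) (Pv , Sv) Pw ¬Tw → let ¬Sw = λ Sw → ¬Tw (Pw , Sw) in
                           trans (uniform t Pu Pw Su ¬Sw) (sym (uniform t Pv Pw Sv ¬Sw))) tw)
    ...   | inj₂ (f , f∈T , f-pres) = inj₂ (f , proj₁ ∘ f∈T , f-pres)

    from-split : Split P → TwinsIn P ⊎ InducedP₄ P
    from-split t with another? t | another? (swap t)
    ... | yes z | _      = from-part t z
    ... | no _  | yes z  = from-part (swap t) z
    ... | no ∄z | no ∄z′ with inner t | outer t
    ...   | x , Px , Sx | y , Py , ¬Sy = inj₁ (x , y , (λ { refl → ¬Sy Sx }) , Px , Py , pair)
      where
      pair : ∀ {w} → P w → w ≢ x → w ≢ y → adj G x w ≡ adj G y w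
      pair {w} Pw w≢x w≢y with side? t w
      ... | yes Sw  = ⊥-elim (∄z (w , (Pw , Sw) , w≢x))
      ... | no ¬Sw = ⊥-elim (∄z′ (w , (Pw , ¬Sw) , w≢y))

-- Modules and rigid cores

record Pattern : Set where
  constructor mkPattern
  field
    {order}   : ℕ
    graph     : Graph order
    separated : Separated graph
open Pattern

toPattern : (X : Graph m) → {True (separated? X)} → Pattern
toPattern X {sep} = mkPattern X (separated-by-decision X sep)

Contains : List Pattern → Adj n → Set
Contains F L = Any (λ P → ∃ (Preserves (adj (graph P)) L)) F

Avoids : List Pattern → Graph n → Set
Avoids F G = All (λ P → ¬ InducedSub (graph P) G) F

contains? : (F : List Pattern) (L : Adj n) → Maybe (Contains F L)
contains? [ₗ]      L = nothing
contains? (P ∷ₗ F) L = mapᴹ here (occurrence? (adj (graph P)) L) <∣> mapᴹ there (contains? F L)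

avoids-contains : {F : List Pattern} {L : Adj k} (G : Graph n) → Avoids F G → Contains F L →
                  (w : Fin k → Fin n) → Preserves L (adj G) w → ⊥
avoids-contains G avoid occurs w w-pres with Any.lookup occurs | All.lookupAny avoid occurs
... | P | P⊄G , f , f-pres =
  P⊄G (preserves⇒InducedSub (graph P) G (separated P)
        (w ∘ f , Preserves-∘ {C = adj G} {f = f} {g = w} f-pres w-pres))

obstructionPatterns : List Pattern
obstructionPatterns = toPattern (cycleG 5) ∷ₗ toPattern house ∷ₗ toPattern gem ∷ₗ
                      toPattern (complement house) ∷ₗ toPattern (complement gem) ∷ₗ [ₗ]

ObstructionFree⇒avoids : (G : Graph n) → ObstructionFree G → Avoids obstructionPatterns G
ObstructionFree⇒avoids G free =
  proj₁ (free C₅) ∷ᵃ proj₁ (free House) ∷ᵃ proj₁ (free Gem) ∷ᵃ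
  (proj₂ (free House) ∘ InducedSub-complement {X = house} {G}) ∷ᵃ
  (proj₂ (free Gem) ∘ InducedSub-complement {X = gem} {G}) ∷ᵃ []ᵃ

P₄-cone-obstructed : ∀ c → Contains obstructionPatterns (extend (const c) (adj P₄))
P₄-cone-obstructed = from-just (all-Bool? λ c → contains? obstructionPatterns (extend (const c) (adj P₄)))

IsModule : Graph n → Pred (Fin n) 0ℓ → Set
IsModule G M = ∀ {x y w} → M x → M y → ¬ M w → adj G x w ≡ adj G y w

module-subsingleton : (G : Graph n) → TwinFree G → Avoids obstructionPatterns G →
                      {M : Pred (Fin n) 0ℓ} → Decidable M → IsModule G M →
                      ∀ {z x y} → ¬ M z → M x → M y → x ≡ y
module-subsingleton G twinFree avoids {M} M? isModule {z} {x} {y} ¬Mz Mx My =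
  decidable-stable (x ≟ y) λ x≢y →
    [ no-twins , no-P₄ ]′ (twins-or-P₄ G M? (⊂-wellFounded ⟦ M? ⟧) Mx My x≢y)
  where
  no-twins : ¬ TwinsIn G M
  no-twins twins with twins-lift G {P = λ _ → ⊤} M? (const tt) (λ Mu Mv _ ¬Mw → isModule Mu Mv ¬Mw) twins
  ... | u , v , u≢v , _ , _ , tw = twinFree u≢v λ w w≢u w≢v → tw tt w≢u w≢v
  no-P₄ : ¬ InducedP₄ G M
  no-P₄ (f , f∈M , f-pres) =
    avoids-contains G avoids (P₄-cone-obstructed (adj G z (f zero))) (z ◂ f)
      (extend-preserves G z f-pres z-row)
    where
    z-row : ∀ j → adj G z (f j) ≡ adj G z (f zero)
    z-row j = adj-sym G (trans (isModule (f∈M j) (f∈M zero) ¬Mz) (symm G (f zero) z))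

RowOf : Graph k → (Fin k → Bool) → Fin k → Set
RowOf A r s = ∀ j → j ≢ s → r j ≡ adj A s j

row : Graph k → Fin k → Bool → Fin k → Bool
row A s b j = if does (j ≟ s) then b else adj A s j

-- The core A is rigid with respect to F: a vertex added to A with adjacencies r either copies
-- the row of some vertex s of A (except possibly at s itself) or creates a member of F, and two
-- added vertices copying distinct s and t create a member of F unless they are joined as s and t.
record Rigid (F : List Pattern) (A : Graph k) : Set where
  field
    separated  : Separated A
    classify   : (r : Vec Bool k) → ∃ (RowOf A (lookup r)) ⊎ Contains F (extend (lookup r) (adj A))
    consistent : ∀ s t → s ≢ t → ∀ bₛ bₜ →
                 Contains F (extend (not (adj A s t) ◂ row A t bₜ) (extend (row A s bₛ) (adj A)))

rigid? : (F : List Pattern) (A : Graph k) → Maybe (Rigid F A)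
rigid? {k} F A = do
  sep ← dec⇒maybe (separated? A)
  cls ← all-Vec? classify?
  con ← all-Fin? λ s → all-Fin? λ t → consistent? s t
  just record { separated = sep ; classify = cls ; consistent = con }
  where
  classify? : (r : Vec Bool k) → Maybe (∃ (RowOf A (lookup r)) ⊎ Contains F (extend (lookup r) (adj A)))
  classify? r =
    mapᴹ inj₁ (dec⇒maybe (any? λ s → all? λ j → ¬? (j ≟ s) →-dec (lookup r j Bool.≟ adj A s j)))
    <∣> mapᴹ inj₂ (contains? F (extend (lookup r) (adj A)))
  consistent? : ∀ s t → Maybe (s ≢ t → ∀ bₛ bₜ →
                  Contains F (extend (not (adj A s t) ◂ row A t bₜ) (extend (row A s bₛ) (adj A))))
  consistent? s t with s ≟ t
  ... | yes s≡t = just λ s≢t → contradiction s≡t s≢t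
  ... | no _    = mapᴹ const (all-Bool? λ bₛ → all-Bool? λ bₜ →
                    contains? F (extend (not (adj A s t) ◂ row A t bₜ) (extend (row A s bₛ) (adj A))))

module Blowup {F : List Pattern} {A : Graph (suc (suc k))} (rigid : Rigid F A)
              {G : Graph n} (twinFree : TwinFree G)
              (avoids : Avoids F G) (avoids₀ : Avoids obstructionPatterns G)
              (σ : Fin (suc (suc k)) → Fin n) (σ-pres : Preserves (adj A) (adj G) σ) where

  σ-row : Fin n → Fin (suc (suc k)) → Bool
  σ-row x j = adj G x (σ j)

  classify-vertex : ∀ x → ∃ (RowOf A (σ-row x))
  classify-vertex x with Rigid.classify rigid (tabulate (σ-row x))
  ... | inj₁ (s , s-row) = s , λ j j≢s → trans (sym (lookup∘tabulate (σ-row x) j)) (s-row j j≢s)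
  ... | inj₂ occurs      = ⊥-elim (avoids-contains G avoids occurs (x ◂ σ)
                             (extend-preserves G x σ-pres λ j → sym (lookup∘tabulate (σ-row x) j)))

  type : Fin n → Fin (suc (suc k))
  type x = proj₁ (classify-vertex x)

  type-row : ∀ x → RowOf A (σ-row x) (type x)
  type-row x = proj₂ (classify-vertex x)

  σ-row≗row : ∀ x j → σ-row x j ≡ row A (type x) (σ-row x (type x)) j
  σ-row≗row x j with j ≟ type x
  ... | yes refl = refl
  ... | no j≢s   = type-row x j j≢s

  type-adj : ∀ x y → type x ≢ type y → adj G x y ≡ adj A (type x) (type y)
  type-adj x y s≢t with adj G x y Bool.≟ adj A (type x) (type y)
  ... | yes xy≡st = xy≡st
  ... | no xy≢st  = ⊥-elim (avoids-contains G avoids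
      (Rigid.consistent rigid (type x) (type y) s≢t (σ-row x (type x)) (σ-row y (type y)))
      (y ◂ (x ◂ σ)) (extend-preserves G y (extend-preserves G x σ-pres (σ-row≗row x)) y-row))
    where
    y-row : ∀ j → adj G y ((x ◂ σ) j) ≡
                  (not (adj A (type x) (type y)) ◂ row A (type y) (σ-row y (type y))) j
    y-row zero    = adj-sym G (Bool.¬-not xy≢st)
    y-row (suc j) = σ-row≗row y j

  type-σ : ∀ j → type (σ j) ≡ j
  type-σ j with type (σ j) ≟ j
  ... | yes s≡j = s≡j
  ... | no s≢j with Rigid.separated rigid (type (σ j)) j s≢j
  ...   | r , r≢s , _ , differ = ⊥-elim (differ (trans (sym (type-row (σ j) r r≢s)) (σ-pres j r)))

  σ-type : ∀ x → x ≡ σ (type x)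
  σ-type x = module-subsingleton G twinFree avoids₀ (λ y → type y ≟ type x) same-type-module
    {z = σ other} (λ t≡s → punchInᵢ≢i (type x) zero (trans (sym (type-σ other)) t≡s))
    refl (type-σ (type x))
    where
    other = punchIn (type x) zero
    same-type-module : IsModule G (λ y → type y ≡ type x)
    same-type-module {u} {v} {w} tu≡s tv≡s tw≢s = begin
      adj G u w               ≡⟨ type-adj u w (λ tu≡tw → tw≢s (trans (sym tu≡tw) tu≡s)) ⟩
      adj A (type u) (type w) ≡⟨ cong (λ s → adj A s (type w)) (trans tu≡s (sym tv≡s)) ⟩
      adj A (type v) (type w) ≡⟨ type-adj v w (λ tv≡tw → tw≢s (trans (sym tv≡tw) tv≡s)) ⟨
      adj G v w               ∎

  G⊆A : InducedSub G A
  G⊆A = type , type-injective , λ x y → begin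
    adj A (type x) (type y)         ≡⟨ σ-pres (type x) (type y) ⟨
    adj G (σ (type x)) (σ (type y)) ≡⟨ cong₂ (adj G) (σ-type x) (σ-type y) ⟨
    adj G x y                       ∎
    where
    type-injective : Injective _≡_ _≡_ type
    type-injective {x} {y} tx≡ty = trans (σ-type x) (trans (cong σ tx≡ty) (sym (σ-type y)))

rigid-core⇒InducedSub : {F : List Pattern} {A : Graph (suc (suc k))} {G : Graph n} → Rigid F A →
                        TwinFree G → Avoids F G → Avoids obstructionPatterns G →
                        InducedSub A G → InducedSub G A
rigid-core⇒InducedSub {G = G} rigid twinFree avoids avoids₀ (σ , _ , σ-pres) =
  Blowup.G⊆A rigid {G = G} twinFree avoids avoids₀ σ σ-pres

-- Reduction to the bull

bull-separated : Separated bull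
bull-separated = separated-by-decision bull _

P₄-separated : Separated P₄
P₄-separated = separated-by-decision P₄ _

P₄⊆bull : InducedSub P₄ bull
P₄⊆bull = preserves⇒InducedSub P₄ bull P₄-separated (from-just (occurrence? (adj P₄) (adj bull)))

bull-rigid : Rigid obstructionPatterns bull
bull-rigid = from-just (rigid? obstructionPatterns bull)

P₄-rigid : Rigid (toPattern bull ∷ₗ obstructionPatterns) P₄
P₄-rigid = from-just (rigid? (toPattern bull ∷ₗ obstructionPatterns) P₄)

twinFree⇒InducedSub-bull : (G : Graph n) → TwinFree G → ObstructionFree G → InducedSub G bull
twinFree⇒InducedSub-bull {zero}        G _ _ = (λ ()) , (λ { {()} }) , λ ()
twinFree⇒InducedSub-bull {suc zero}    G _ _ =
  (λ _ → zero) , (λ { {zero} {zero} _ → refl }) , λ { zero zero → sym (irrefl G zero) }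
twinFree⇒InducedSub-bull {suc (suc n)} G twinFree free =
  [ no-twins , from-P₄ ]′
    (twins-or-P₄ G {P = λ _ → ⊤} (λ _ → yes tt) (⊂-wellFounded _) {zero} {suc zero} tt tt λ ())
  where
  avoids₀ : Avoids obstructionPatterns G
  avoids₀ = ObstructionFree⇒avoids G free
  no-twins : TwinsIn G (λ _ → ⊤) → InducedSub G bull
  no-twins (u , v , u≢v , _ , _ , tw) = ⊥-elim (twinFree u≢v λ w w≢u w≢v → tw tt w≢u w≢v)
  from-P₄ : InducedP₄ G (λ _ → ⊤) → InducedSub G bull
  from-P₄ (σ , _ , σ-pres) = bull-or-P₄ (InducedSub? bull bull-separated G)
    where
    bull-or-P₄ : Dec (InducedSub bull G) → InducedSub G bull
    bull-or-P₄ (yes bull⊆G) = rigid-core⇒InducedSub {G = G} bull-rigid twinFree avoids₀ avoids₀ bull⊆G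
    bull-or-P₄ (no bull⊄G)  = InducedSub-trans {X = G} {P₄} {bull}
      (rigid-core⇒InducedSub {G = G} P₄-rigid twinFree (bull⊄G ∷ᵃ avoids₀) avoids₀
        (preserves⇒InducedSub P₄ G P₄-separated (σ , σ-pres)))
      P₄⊆bull

ObstructionFree⇒twin-elimination : (G : Graph n) → ObstructionFree G →
                                   Σ ℕ λ m → Σ (Graph m) λ H → G ⇝ H × InducedSub H bull
ObstructionFree⇒twin-elimination {zero}  G free = 0 , G , done , twinFree⇒InducedSub-bull G (λ { {()} }) free
ObstructionFree⇒twin-elimination {suc n} G free with any? (λ u → any? λ v → ¬? (u ≟ v) ×-dec twins? G u v)
... | no ∄twins =
  suc n , G , done , twinFree⇒InducedSub-bull G (λ u≢v tw → ∄twins (_ , _ , u≢v , tw)) free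
... | yes (u , v , u≢v , tw)
  with ObstructionFree⇒twin-elimination (deleteV G v)
         (ObstructionFree-mono {H = deleteV G v} {G} (deleteV-sub G v) free)
...   | m , H , G-v⇝H , H⊆bull = m , H , elim u v u≢v tw G-v⇝H , H⊆bull

mainTheorem7 : ∀ n (G : Graph n) → Connected G →
    ((DistanceHereditary G × DistanceHereditary (complement G)) ⇔
     Σ ℕ (λ m → Σ (Graph m) (λ H → (G ⇝ H) × InducedSub H bull)))
mainTheorem7 n G _ = mk⇔
  (λ (dh , dhᶜ) → ObstructionFree⇒twin-elimination G (DH⇒ObstructionFree G dh dhᶜ))
  (λ (_ , _ , G⇝H , H⊆bull) →
    let free = ⇝-ObstructionFree G⇝H H⊆bull in
    ObstructionFree⇒DH G free , ObstructionFree⇒DH (complement G) (ObstructionFree-complement G free))
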